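{- For integers $t\ge 0$, $k\ge 1$ define \[ \beta_{t,k}=\sqrt{1-\frac{2k-1}{t^2+k^2}},\qquad \gamma_{t,k}=\sqrt{1-\frac{2(k-t)}{(k-t)^2+2t(k-1)+1}} \] (whenever the radicand is nonnegative and the denominator nonzero). For integers $2\le m\le n$ with $k=\lfloor n/2\rfloor$, $t=\lfloor m/2\rfloor$, let $\alpha(m,n)=1$ if $n$ is odd, or $m=n$, or $m=2$; otherwise let $\alpha(m,n)=\beta_{t,k}$ if $m$ is odd and $n$ is even, and $\alpha(m,n)=\gamma_{t,k}$ if $m$ and $n$ are both even. Then: (a) $\alpha(m,n)\ge \frac{\sqrt{10}}{5}$ for all integers $2\le m\le n$; (b) for every fixed $t$, $\lim_{k\to\infty}\beta_{t,k}=\lim_{k\to\infty}\gamma_{t,k}=1$; (c) $\lim_{t\to\infty,\,k\to\infty}\beta_{t,k}=\lim_{t\to\infty,\,k\to\infty}\gamma_{t,k}=1$.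
   Context: In the paper, $\alpha(m,n)$ is the approximation guarantee of a linear-time algorithm for the maximum scatter TSP on the $m\times n$ integer grid $\{(x,y)\in\mathbb{Z}^2:1\le x\le n,1\le y\le m\}$ with Euclidean distances (maximize the shortest edge of a Hamiltonian cycle in the complete graph on the grid points): the produced tour has shortest edge at least $\alpha(m,n)$ times the optimum. -}

module Defs where

open import Data.Bool using (Bool; true; false; _∨_; if_then_else_)
open import Data.Nat as ℕ using (ℕ; zero; suc; _≡ᵇ_; _%_)
import Data.Nat as N
open import Data.Integer as ℤ using (ℤ; +_)
open import Data.Rational as ℚ using (ℚ; 1ℚ; 0ℚ; _-_; _+_; _*_; _<_; _≤_)
open import Data.Product using (_×_)
open import Data.Sum using (_⊎_)

-- Fraction p / d of an integer by a natural number; the value for d = 0 is an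
-- arbitrary junk value 0 and is never used (all denominators below are
-- positive under the standing hypotheses t ≥ 0, k ≥ 1).
frac : ℤ → ℕ → ℚ
frac p zero    = 0ℚ
frac p (suc d) = p ℚ./ suc d

βsq : ℕ → ℕ → ℚ
βsq t k = 1ℚ - frac ((+ 2) ℤ.* (+ k) ℤ.- (+ 1)) (t N.* t N.+ k N.* k)

-- Radicand of γ_{t,k} = sqrt (1 - 2(k-t)/((k-t)² + 2t(k-1) + 1)).
-- The denominator is computed in ℤ; for k ≥ 1 it is positive, so ∣_∣ is the identity on it.
γden : ℕ → ℕ → ℤ
γden t k = (+ k ℤ.- + t) ℤ.* (+ k ℤ.- + t) ℤ.+ (+ 2) ℤ.* (+ t) ℤ.* (+ k ℤ.- + 1) ℤ.+ + 1

γsq : ℕ → ℕ → ℚ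
γsq t k = 1ℚ - frac ((+ 2) ℤ.* (+ k ℤ.- + t)) ℤ.∣ γden t k ∣

αsq : ℕ → ℕ → ℚ
αsq m n =
  if (n % 2 ≡ᵇ 1) ∨ (m ≡ᵇ n) ∨ (m ≡ᵇ 2) then 1ℚ
  else (if m % 2 ≡ᵇ 1 then βsq (m N./ 2) (n N./ 2) else γsq (m N./ 2) (n N./ 2))

-- Nonnegative real numbers of the form √q with q a (nonnegative) rational.
-- All quantities in the statement (β, γ, α, √10/5 = √(2/5), 1 = √1) are of this form.
record Sqrtℚ : Set where
  constructor √_
  field radicand : ℚ
open Sqrtℚ public

-- Order between square roots of nonnegative rationals: √a ≤ √b ⇔ a ≤ b.
_≤√_ : Sqrtℚ → Sqrtℚ → Set
x ≤√ y = radicand x ≤ radicand y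

-- |√q - 1| < ε, for rational ε > 0 and q ≥ 0:
--   √q < 1 + ε  ⇔  q < (1+ε)²,   and   1 - ε < √q  ⇔  1 - ε < 0  or  (1-ε)² < q.
dist1< : Sqrtℚ → ℚ → Set
dist1< x ε = (radicand x < (1ℚ + ε) * (1ℚ + ε))
           × ((1ℚ - ε < 0ℚ) ⊎ ((1ℚ - ε) * (1ℚ - ε) < radicand x))

β : ℕ → ℕ → Sqrtℚ
β t k = √ βsq t k

γ : ℕ → ℕ → Sqrtℚ
γ t k = √ γsq t k

α : ℕ → ℕ → Sqrtℚ
α m n = √ αsq m n

-- √10 / 5 = √(10/25) = √(2/5)
√10/5 : Sqrtℚ
√10/5 = √ ((+ 2) ℚ./ 5)

{-# OPTIONS --safe #-}
-- (a) Writing m = 2t+1 or 2t and n = 2k, the bound α² ≥ 2/5 becomes, after clearing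
-- denominators, 5(2k−1) ≤ 3(t²+k²) for t ≥ 1, k ≥ 2, and 10(k−t) ≤ 3((k−t)²+2t(k−1)+1)
-- for 2 ≤ t < k, where 2t(k−1) ≥ 4(k−t) does the work.
-- (b), (c) Both radicands are 1 − p/D, and |p/D| < ε gives |√(1 − p/D) − 1| < ε because
-- (1−ε)² ≤ 1−ε < 1 − p/D < 1+ε ≤ (1+ε)². The denominator grows quadratically and the
-- numerator linearly: with d the denominator of ε, |p|·d < D holds for β once k > 2d,
-- and for γ once moreover |k−t| ≥ 2d or t ≥ 2d.
module Submission where

open import Defs
open import Data.Nat using (ℕ; _≤_)
open import Data.Product using (_×_; ∃-syntax)
open import Data.Rational using (ℚ; 0ℚ; _<_)

open import Data.Rational using (1ℚ)
open import Data.Bool using (true; false)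
open import Data.Nat as ℕ using (zero; suc; _+_; _*_; _∸_; _%_; _/_; _≡ᵇ_; z≤n; s≤s)
import Data.Nat.Properties as ℕₚ
open import Data.Nat.DivMod using (m≡m%n+[m/n]*n; m%n<n)
open import Data.Nat.Tactic.RingSolver using (solve-∀)
open import Data.Integer as ℤ using (ℤ; +_; -[1+_]; +[1+_]; ∣_∣)
import Data.Integer.Properties as ℤₚ
import Data.Rational as ℚ
import Data.Rational.Properties as ℚₚ
open import Algebra.Properties.Group ℚₚ.+-0-group using (⁻¹-involutive)
import Data.Rational.Unnormalised as ℚᵘ
import Data.Rational.Unnormalised.Properties as ℚᵘₚ
open import Data.Product using (_,_; uncurry)
open import Data.Sum using (_⊎_; inj₁; inj₂)
open import Relation.Nullary using (yes; no; contradiction)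
open import Relation.Binary.PropositionalEquality

1≤p⇒p≤p*p : ∀ {p} → 1ℚ ℚ.≤ p → p ℚ.≤ p ℚ.* p
1≤p⇒p≤p*p {p} 1≤p = subst (ℚ._≤ p ℚ.* p) (ℚₚ.*-identityʳ p)
  (ℚₚ.*-monoˡ-≤-nonNeg p {{ℚ.nonNegative (ℚₚ.≤-trans (ℚ.*≤* (ℤ.+≤+ z≤n)) 1≤p)}} 1≤p)

0≤p≤1⇒p*p≤p : ∀ {p} → 0ℚ ℚ.≤ p → p ℚ.≤ 1ℚ → p ℚ.* p ℚ.≤ p
0≤p≤1⇒p*p≤p {p} 0≤p p≤1 = subst (p ℚ.* p ℚ.≤_) (ℚₚ.*-identityʳ p)
  (ℚₚ.*-monoˡ-≤-nonNeg p {{ℚ.nonNegative 0≤p}} p≤1)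

√1-x-within : ∀ {ε x} → 0ℚ < ε → ℚ.- ε < x → x < ε → dist1< (√ (1ℚ ℚ.- x)) ε
√1-x-within {ε} {x} 0<ε -ε<x x<ε = upper , lower
  where
  -x<ε : ℚ.- x < ε
  -x<ε = subst (ℚ.- x <_) (⁻¹-involutive ε) (ℚₚ.neg-antimono-< -ε<x)
  upper : 1ℚ ℚ.- x < (1ℚ ℚ.+ ε) ℚ.* (1ℚ ℚ.+ ε)
  upper = ℚₚ.<-≤-trans (ℚₚ.+-monoʳ-< 1ℚ -x<ε)
            (1≤p⇒p≤p*p (ℚₚ.+-monoʳ-≤ 1ℚ (ℚₚ.<⇒≤ 0<ε)))
  lower : (1ℚ ℚ.- ε < 0ℚ) ⊎ ((1ℚ ℚ.- ε) ℚ.* (1ℚ ℚ.- ε) < 1ℚ ℚ.- x)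
  lower with 1ℚ ℚ.- ε ℚ.<? 0ℚ
  ... | yes 1-ε<0 = inj₁ 1-ε<0
  ... | no 1-ε≮0 = inj₂ (ℚₚ.≤-<-trans
          (0≤p≤1⇒p*p≤p (ℚₚ.≮⇒≥ 1-ε≮0) (ℚₚ.+-monoʳ-≤ 1ℚ (ℚₚ.neg-antimono-≤ (ℚₚ.<⇒≤ 0<ε))))
          (ℚₚ.+-monoʳ-< 1ℚ (ℚₚ.neg-antimono-< x<ε)))

i≤+∣i∣ : ∀ i → i ℤ.≤ + ∣ i ∣
i≤+∣i∣ (+ n)    = ℤₚ.≤-refl
i≤+∣i∣ -[1+ n ] = ℤ.-≤+

-+∣i∣≤i : ∀ i → ℤ.- + ∣ i ∣ ℤ.≤ i
-+∣i∣≤i (+ n)    = ℤₚ.neg-≤-pos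
-+∣i∣≤i -[1+ n ] = ℤₚ.≤-refl

i*i≡+∣i∣*∣i∣ : ∀ i → i ℤ.* i ≡ + (∣ i ∣ * ∣ i ∣)
i*i≡+∣i∣*∣i∣ (+ n)    = sym (ℤₚ.pos-* n n)
i*i≡+∣i∣*∣i∣ -[1+ n ] = refl

toℚᵘ-frac : ∀ p d → ℚᵘ._≃_ (ℚ.toℚᵘ (frac p (suc d))) (ℚᵘ.mkℚᵘ p d)
toℚᵘ-frac p d = ℚₚ.toℚᵘ-fromℚᵘ (ℚᵘ.mkℚᵘ p d)

frac-≤ : ∀ p D a b → 0 ℕ.< D → ∣ p ∣ * suc b ≤ a * D → frac p D ℚ.≤ + a ℚ./ suc b
frac-≤ p (suc d) a b _ ∣p∣b≤aD = ℚₚ.toℚᵘ-cancel-≤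
  (ℚᵘₚ.≤-respʳ-≃ (ℚᵘₚ.≃-sym (toℚᵘ-frac (+ a) b))
  (ℚᵘₚ.≤-respˡ-≃ (ℚᵘₚ.≃-sym (toℚᵘ-frac p d)) (ℚᵘ.*≤* cross)))
  where
  open ℤₚ.≤-Reasoning
  cross : p ℤ.* + suc b ℤ.≤ + a ℤ.* + suc d
  cross = begin
    p ℤ.* + suc b       ≤⟨ ℤₚ.*-monoʳ-≤-nonNeg (+ suc b) (i≤+∣i∣ p) ⟩
    + ∣ p ∣ ℤ.* + suc b ≡⟨ ℤₚ.pos-* ∣ p ∣ (suc b) ⟨
    + (∣ p ∣ * suc b)   ≤⟨ ℤ.+≤+ ∣p∣b≤aD ⟩
    + (a * suc d)       ≡⟨ ℤₚ.pos-* a (suc d) ⟩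
    + a ℤ.* + suc d     ∎

-- As ↥ ε ≥ 1 we have ε ≥ 1 / ↧ ε, so ∣ p ∣ / D < 1 / ↧ ε suffices.
frac-within : ∀ p D {ε} → 0ℚ < ε → ∣ p ∣ * ℚ.↧ₙ ε ℕ.< D → ℚ.- ε < frac p D × frac p D < ε
frac-within p (suc d) {ℚ.mkℚ +[1+ n ] e _} _ ∣p∣e<D = lower , upper
  where
  open ℤₚ.≤-Reasoning
  ∣pe∣<εD : + ∣ p ℤ.* + suc e ∣ ℤ.< +[1+ n ] ℤ.* + suc d
  ∣pe∣<εD = begin-strict
    + ∣ p ℤ.* + suc e ∣ ≡⟨ cong +_ (ℤₚ.abs-* p (+ suc e)) ⟩
    + (∣ p ∣ * suc e)   <⟨ ℤ.+<+ ∣p∣e<D ⟩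
    + suc d             ≤⟨ ℤ.+≤+ (ℕₚ.m≤n*m (suc d) (suc n)) ⟩
    +[1+ n ] ℤ.* + suc d ∎
  upper : frac p (suc d) < ℚ.mkℚ +[1+ n ] e _
  upper = ℚₚ.toℚᵘ-cancel-< (ℚᵘₚ.<-respˡ-≃ (ℚᵘₚ.≃-sym (toℚᵘ-frac p d))
    (ℚᵘ.*<* (ℤₚ.≤-<-trans (i≤+∣i∣ _) ∣pe∣<εD)))
  lower : ℚ.- ℚ.mkℚ +[1+ n ] e _ < frac p (suc d)
  lower = ℚₚ.toℚᵘ-cancel-< (ℚᵘₚ.<-respʳ-≃ (ℚᵘₚ.≃-sym (toℚᵘ-frac p d))
    (ℚᵘ.*<* (begin-strict
      -[1+ n ] ℤ.* + suc d       ≡⟨ ℤₚ.neg-distribˡ-* +[1+ n ] (+ suc d) ⟨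
      ℤ.- (+[1+ n ] ℤ.* + suc d) <⟨ ℤₚ.neg-mono-< ∣pe∣<εD ⟩
      ℤ.- + ∣ p ℤ.* + suc e ∣    ≤⟨ -+∣i∣≤i _ ⟩
      p ℤ.* + suc e              ∎)))
frac-within p (suc d) {ℚ.mkℚ (+ zero) e _} (ℚ.*<* (ℤ.+<+ ())) _
frac-within p (suc d) {ℚ.mkℚ -[1+ _ ] _ _} (ℚ.*<* ()) _

√1-frac-within : ∀ p D {ε} → 0ℚ < ε → ∣ p ∣ * ℚ.↧ₙ ε ℕ.< D → dist1< (√ (1ℚ ℚ.- frac p D)) ε
√1-frac-within p D 0<ε ∣p∣e<D = uncurry (√1-x-within 0<ε) (frac-within p D 0<ε ∣p∣e<D)

gap : ℕ → ℕ → ℕ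
gap k t = ∣ + k ℤ.- + t ∣

gap≡∸ : ∀ {k t} → t ≤ k → gap k t ≡ k ∸ t
gap≡∸ {k} {t} t≤k = cong ∣_∣ (trans (ℤₚ.m-n≡m⊖n k t) (ℤₚ.⊖-≥ t≤k))

∣βnum∣ : ∀ k → ∣ + 2 ℤ.* + suc k ℤ.- + 1 ∣ ≡ suc (2 * k)
∣βnum∣ k = ℕₚ.+-suc k (k + 0)

∣γnum∣ : ∀ k t → ∣ + 2 ℤ.* (+ k ℤ.- + t) ∣ ≡ 2 * gap k t
∣γnum∣ k t = ℤₚ.abs-* (+ 2) (+ k ℤ.- + t)

∣γden∣ : ∀ t k → ∣ γden t (suc k) ∣ ≡ gap (suc k) t * gap (suc k) t + 2 * t * k + 1
∣γden∣ t k = cong ∣_∣ (begin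
    i ℤ.* i ℤ.+ + 2 ℤ.* + t ℤ.* + k ℤ.+ + 1  ≡⟨ cong₂ (λ a b → a ℤ.+ b ℤ.+ + 1) (i*i≡+∣i∣*∣i∣ i) 2tk ⟩
    + (X * X) ℤ.+ + (2 * t * k) ℤ.+ + 1      ≡⟨ cong (ℤ._+ + 1) (ℤₚ.pos-+ (X * X) (2 * t * k)) ⟨
    + (X * X + 2 * t * k) ℤ.+ + 1            ≡⟨ ℤₚ.pos-+ (X * X + 2 * t * k) 1 ⟨
    + (X * X + 2 * t * k + 1)                ∎)
  where
  open ≡-Reasoning
  i : ℤ
  i = + suc k ℤ.- + t
  X : ℕ
  X = ∣ i ∣
  2tk : + 2 ℤ.* + t ℤ.* + k ≡ + (2 * t * k)
  2tk = sym (trans (ℤₚ.pos-* (2 * t) k) (cong (ℤ._* + k) (ℤₚ.pos-* 2 t)))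

2/5 : ℚ
2/5 = + 2 ℚ./ 5

2/5≤1 : 2/5 ℚ.≤ 1ℚ
2/5≤1 = ℚ.*≤* (ℤ.+≤+ (s≤s (s≤s z≤n)))

2/5≤1-p : ∀ {p} → p ℚ.≤ + 3 ℚ./ 5 → 2/5 ℚ.≤ 1ℚ ℚ.- p
2/5≤1-p p≤3/5 = ℚₚ.+-monoʳ-≤ 1ℚ (ℚₚ.neg-antimono-≤ p≤3/5)

βsq≥2/5 : ∀ t k → 2 ≤ 1 + t * 2 → 1 + t * 2 ℕ.< k * 2 → 2/5 ℚ.≤ βsq t k
βsq≥2/5 zero    _             (s≤s ()) _
βsq≥2/5 (suc t) zero          _        ()
βsq≥2/5 (suc t) (suc zero)    _        (s≤s (s≤s ()))
βsq≥2/5 (suc t) (suc (suc k)) _        _ =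
  2/5≤1-p (frac-≤ (+ 2 ℤ.* + suc (suc k) ℤ.- + 1) D 3 4 (s≤s z≤n)
    (subst (λ a → a * 5 ≤ 3 * D) (sym (∣βnum∣ (suc k))) num*5≤3*den))
  where
  D : ℕ
  D = suc t * suc t + suc (suc k) * suc (suc k)
  expand : ∀ t k → 3 * (suc t * suc t + suc (suc k) * suc (suc k))
                   ≡ suc (2 * suc k) * 5 + (3 * t * t + 6 * t + 3 * k * k + 2 * k)
  expand = solve-∀
  num*5≤3*den : suc (2 * suc k) * 5 ≤ 3 * D
  num*5≤3*den = subst (suc (2 * suc k) * 5 ≤_) (sym (expand t k)) (ℕₚ.m≤m+n _ _)

γsq≥2/5 : ∀ t k → 2 ≤ t * 2 → t * 2 ≢ 2 → t * 2 ℕ.< k * 2 → 2/5 ℚ.≤ γsq t k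
γsq≥2/5 zero              _       () _   _
γsq≥2/5 (suc zero)        _       _  t≢1 _ = contradiction refl t≢1
γsq≥2/5 (suc (suc _))     zero    _  _   ()
γsq≥2/5 t@(suc (suc t-2)) (suc k) _  _   2t<2k =
  2/5≤1-p (frac-≤ (+ 2 ℤ.* (+ suc k ℤ.- + t)) ∣ γden t (suc k) ∣ 3 4 0<den
    (subst₂ (λ a b → a * 5 ≤ 3 * b) (sym (∣γnum∣ (suc k) t)) (sym (∣γden∣ t k)) num*5≤3*den))
  where
  X : ℕ
  X = gap (suc k) t
  X≤k : X ≤ k
  X≤k = subst (_≤ k) (sym (gap≡∸ (ℕₚ.<⇒≤ (ℕₚ.*-cancelʳ-< 2 t (suc k) 2t<2k)))) (ℕₚ.m∸n≤m k (suc t-2))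
  0<den : 0 ℕ.< ∣ γden t (suc k) ∣
  0<den = subst (0 ℕ.<_) (sym (∣γden∣ t k)) (ℕₚ.m≤n+m 1 _)
  num*5≤3*den : 2 * X * 5 ≤ 3 * (X * X + 2 * t * k + 1)
  num*5≤3*den = begin
    2 * X * 5                   ≤⟨ ℕₚ.m≤m+n _ (2 * X) ⟩
    2 * X * 5 + 2 * X           ≡⟨ regroup X ⟩
    3 * (2 * 2 * X)             ≤⟨ ℕₚ.*-monoʳ-≤ 3 (ℕₚ.*-mono-≤ (ℕₚ.*-monoʳ-≤ 2 {2} {t} (s≤s (s≤s z≤n))) X≤k) ⟩
    3 * (2 * t * k)             ≤⟨ ℕₚ.*-monoʳ-≤ 3 (ℕₚ.≤-trans (ℕₚ.m≤n+m _ (X * X)) (ℕₚ.m≤m+n _ 1)) ⟩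
    3 * (X * X + 2 * t * k + 1) ∎
    where
    open ℕₚ.≤-Reasoning
    regroup : ∀ X → 2 * X * 5 + 2 * X ≡ 3 * (2 * 2 * X)
    regroup = solve-∀

-- Matching on ≡⇒≡ᵇ next to each boolean test turns its false branch into the
-- corresponding disequality.
α≥√10/5 : ∀ m n → 2 ≤ m → m ≤ n → √10/5 ≤√ α m n
α≥√10/5 m n 2≤m m≤n with n % 2 | m%n<n n 2 | m≡m%n+[m/n]*n n 2
... | suc (suc _) | s≤s (s≤s ()) | _
... | 1 | _ | _ = 2/5≤1
... | 0 | _ | n≡2k with m ≡ᵇ n | ℕₚ.≡⇒≡ᵇ m n
...   | true  | _   = 2/5≤1
...   | false | m≢n with m ≡ᵇ 2 | ℕₚ.≡⇒≡ᵇ m 2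
...     | true  | _   = 2/5≤1
...     | false | m≢2 with m % 2 | m%n<n m 2 | m≡m%n+[m/n]*n m 2
...       | suc (suc _) | s≤s (s≤s ()) | _
...       | 1 | _ | m≡1+2t =
  βsq≥2/5 (m / 2) (n / 2) (subst (2 ≤_) m≡1+2t 2≤m) (subst₂ ℕ._<_ m≡1+2t n≡2k (ℕₚ.≤∧≢⇒< m≤n m≢n))
...       | 0 | _ | m≡2t =
  γsq≥2/5 (m / 2) (n / 2) (subst (2 ≤_) m≡2t 2≤m) (subst (_≢ 2) m≡2t m≢2) (subst₂ ℕ._<_ m≡2t n≡2k (ℕₚ.≤∧≢⇒< m≤n m≢n))

β-within : ∀ t {k ε} → 0ℚ < ε → 2 * ℚ.↧ₙ ε ≤ k → dist1< (β t (suc k)) ε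
β-within t {k} {ε} 0<ε 2d≤k = √1-frac-within (+ 2 ℤ.* + suc k ℤ.- + 1) (t * t + suc k * suc k) 0<ε
  (subst (λ a → a * d ℕ.< t * t + suc k * suc k) (sym (∣βnum∣ k)) num*d<den)
  where
  d : ℕ
  d = ℚ.↧ₙ ε
  open ℕₚ.≤-Reasoning
  regroup : ∀ k d → suc (suc (2 * k)) * d ≡ suc k * (2 * d)
  regroup = solve-∀
  num*d<den : suc (2 * k) * d ℕ.< t * t + suc k * suc k
  num*d<den = begin-strict
    suc (2 * k) * d       ≤⟨ ℕₚ.*-monoˡ-≤ d (ℕₚ.n≤1+n (suc (2 * k))) ⟩
    suc (suc (2 * k)) * d ≡⟨ regroup k d ⟩
    suc k * (2 * d)       ≤⟨ ℕₚ.*-monoʳ-≤ (suc k) 2d≤k ⟩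
    suc k * k             <⟨ ℕₚ.*-monoʳ-< (suc k) (ℕₚ.n<1+n k) ⟩
    suc k * suc k         ≤⟨ ℕₚ.m≤n+m _ (t * t) ⟩
    t * t + suc k * suc k ∎

γ-within : ∀ t {k ε} → 0ℚ < ε → 2 * ℚ.↧ₙ ε ≤ k → 2 * ℚ.↧ₙ ε ≤ gap (suc k) t ⊎ 2 * ℚ.↧ₙ ε ≤ t →
           dist1< (γ t (suc k)) ε
γ-within t {k} {ε} 0<ε 2d≤k 2d≤X⊎2d≤t =
  √1-frac-within (+ 2 ℤ.* (+ suc k ℤ.- + t)) ∣ γden t (suc k) ∣ 0<ε
    (subst₂ (λ a b → a * d ℕ.< b) (sym (∣γnum∣ (suc k) t)) (sym (∣γden∣ t k))
      (ℕₚ.≤-<-trans (num*d≤den 2d≤X⊎2d≤t) (ℕₚ.m<m+n _ ℕₚ.0<1+n)))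
  where
  d : ℕ
  d = ℚ.↧ₙ ε
  X : ℕ
  X = gap (suc k) t
  open ℕₚ.≤-Reasoning
  regroup : ∀ X d → 2 * X * d ≡ X * (2 * d)
  regroup = solve-∀
  num*d≤den : 2 * d ≤ X ⊎ 2 * d ≤ t → 2 * X * d ≤ X * X + 2 * t * k
  num*d≤den (inj₁ 2d≤X) = begin
    2 * X * d          ≡⟨ regroup X d ⟩
    X * (2 * d)        ≤⟨ ℕₚ.*-monoʳ-≤ X 2d≤X ⟩
    X * X              ≤⟨ ℕₚ.m≤m+n _ _ ⟩
    X * X + 2 * t * k  ∎
  num*d≤den (inj₂ 2d≤t) with ℕₚ.≤-total (2 * d) X
  ... | inj₁ 2d≤X = num*d≤den (inj₁ 2d≤X)
  ... | inj₂ X≤2d = begin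
    2 * X * d          ≤⟨ ℕₚ.*-mono-≤ (ℕₚ.*-monoʳ-≤ 2 (ℕₚ.≤-trans X≤2d 2d≤t)) (ℕₚ.m+n≤o⇒m≤o d 2d≤k) ⟩
    2 * t * k          ≤⟨ ℕₚ.m≤n+m _ _ ⟩
    X * X + 2 * t * k  ∎

β,γ→1-as-k→∞ : ∀ t ε → 0ℚ < ε →
  ∃[ K ] ∀ k → 1 ≤ k → K ≤ k → dist1< (β t k) ε × dist1< (γ t k) ε
β,γ→1-as-k→∞ t ε 0<ε = suc (2 * d + t) , near
  where
  d : ℕ
  d = ℚ.↧ₙ ε
  near : ∀ k → 1 ≤ k → suc (2 * d + t) ≤ k → dist1< (β t k) ε × dist1< (γ t k) ε
  near (suc k) _ (s≤s 2d+t≤k) = β-within t 0<ε 2d≤k , γ-within t 0<ε 2d≤k (inj₁ 2d≤X)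
    where
    2d+t≤1+k : 2 * d + t ≤ suc k
    2d+t≤1+k = ℕₚ.m≤n⇒m≤1+n 2d+t≤k
    2d≤k : 2 * d ≤ k
    2d≤k = ℕₚ.m+n≤o⇒m≤o (2 * d) 2d+t≤k
    2d≤X : 2 * d ≤ gap (suc k) t
    2d≤X = subst (2 * d ≤_) (sym (gap≡∸ (ℕₚ.m+n≤o⇒n≤o (2 * d) 2d+t≤1+k)))
             (ℕₚ.m+n≤o⇒m≤o∸n (2 * d) 2d+t≤1+k)

β,γ→1-as-t,k→∞ : ∀ ε → 0ℚ < ε →
  ∃[ N ] ∀ t k → 1 ≤ k → N ≤ t → N ≤ k → dist1< (β t k) ε × dist1< (γ t k) ε
β,γ→1-as-t,k→∞ ε 0<ε = suc (2 * ℚ.↧ₙ ε) , near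
  where
  near : ∀ t k → 1 ≤ k → suc (2 * ℚ.↧ₙ ε) ≤ t → suc (2 * ℚ.↧ₙ ε) ≤ k →
         dist1< (β t k) ε × dist1< (γ t k) ε
  near t (suc k) _ 2d<t (s≤s 2d≤k) =
    β-within t 0<ε 2d≤k , γ-within t 0<ε 2d≤k (inj₂ (ℕₚ.<⇒≤ 2d<t))

corollary1 :
    (∀ (m n : ℕ) → 2 ≤ m → m ≤ n → √10/5 ≤√ α m n)
    × (∀ (t : ℕ) → ∀ (ε : ℚ) → 0ℚ < ε →
         ∃[ K ] ∀ (k : ℕ) → 1 ≤ k → K ≤ k → dist1< (β t k) ε × dist1< (γ t k) ε)
    × (∀ (ε : ℚ) → 0ℚ < ε →
         ∃[ N ] ∀ (t k : ℕ) → 1 ≤ k → N ≤ t → N ≤ k → dist1< (β t k) ε × dist1< (γ t k) ε)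
corollary1 = α≥√10/5 , β,γ→1-as-k→∞ , β,γ→1-as-t,k→∞
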